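{- Let $k\geq 2$ be an integer, let $r=\lfloor \log_2(k)\rfloor+1$, and let $$c_0(k)=\frac{1}{2^r}\sum_{m=0}^{2^r-1}(-1)^{\binom{m}{k}}.$$ Then $$c_0(k)=\frac{2^{w_2(k)-1}-1}{2^{w_2(k)-1}},$$ where $w_2(k)$ is the sum of the binary digits of $k$. In particular, $c_0(k)=0$ if and only if $k$ is a power of two.
   Context: $c_0(k)$ is the coefficient of $2^n$ in the closed-form expansion of the exponential sum $S(\sigma_{n,k})=\sum_{j=0}^n(-1)^{\binom{j}{k}}\binom{n}{j}$ of the elementary symmetric Boolean polynomial $\sigma_{n,k}$ of degree $k$ in $n$ variables over $\mathbb{F}_2$. -}

module Defs where

open import Data.Nat using (ℕ; zero; suc; _+_; _*_; _∸_; _^_; _%_; _/_)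
open import Data.Nat.Combinatorics using (_C_)
open import Data.Nat.Logarithm using (⌊log₂_⌋)
open import Data.Nat.Properties using (m^n≢0)
open import Data.Integer as ℤ using (ℤ; +_)
open import Data.Rational as ℚ using (ℚ)

negOnePow : ℕ → ℤ
negOnePow n with n % 2
... | zero = + 1
... | suc _ = ℤ.- (+ 1)

signSum : ℕ → ℕ → ℤ
signSum k zero = + 0
signSum k (suc N) = signSum k N ℤ.+ negOnePow (N C k)

r : ℕ → ℕ
r k = ⌊log₂ k ⌋ + 1

c₀ : ℕ → ℚ
c₀ k = ℚ._/_ (signSum k (2 ^ r k)) (2 ^ r k) {{m^n≢0 2 (r k)}}

-- binary digit sum w₂(n), computed with fuel (n itself suffices since n/2 < n)
w₂-fuel : ℕ → ℕ → ℕ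
w₂-fuel zero n = 0
w₂-fuel (suc f) n = n % 2 + w₂-fuel f (n / 2)

w₂ : ℕ → ℕ
w₂ n = w₂-fuel n n

closedForm : ℕ → ℚ
closedForm w = ℚ._/_ (+ (2 ^ (w ∸ 1)) ℤ.- + 1) (2 ^ (w ∸ 1)) {{m^n≢0 2 (w ∸ 1)}}

{-# OPTIONS --safe #-}
module Submission where

-- By Lucas' theorem at the prime 2, binom(2a + i, 2c + j) ≡ binom(a, c) · binom(i, j) (mod 2).
-- Hence the number of m < 2^(R+1) with binom(m, k) odd is twice (k even) or equal to (k odd)
-- the number of m < 2^R with binom(m, ⌊k/2⌋) odd, so by induction on R it is 2^R / 2^w₂(k)
-- whenever k < 2^R. These m contribute -1 to the sign sum and all other m contribute +1,
-- so c₀(k) = 1 - 2 / 2^w₂(k), which vanishes exactly when w₂(k) = 1.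

open import Data.Nat
open import Data.Nat.Properties
open import Data.Nat.DivMod
open import Data.Nat.Induction using (<-wellFounded)
open import Induction.WellFounded using (Acc; acc)
open import Data.Nat.Combinatorics using (_C_; nCk+nC[k+1]≡[n+1]C[k+1])
open import Data.Nat.Logarithm using (⌊log₂_⌋; ⌊log₂⌋-mono-≤; ⌊log₂[2^n]⌋≡n)
open import Data.Integer as ℤ using (+_)
import Data.Integer.Properties as ℤ
open import Data.Integer.Tactic.RingSolver using (solve-∀)
open import Data.Rational as ℚ using (0ℚ)
open import Data.Rational.Properties using (fromℚᵘ-cong; fromℚᵘ-injective)
open import Data.Rational.Unnormalised.Base using (*≡*; mkℚᵘ)
open import Data.Product using (Σ; _,_; _×_)
open import Function.Bundles using (_⇔_; mk⇔)
open import Relation.Nullary using (contradiction)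
open import Relation.Binary.PropositionalEquality
open import Defs

2*[1+n]≡2+2*n : ∀ n → 2 * suc n ≡ suc (suc (2 * n))
2*[1+n]≡2+2*n n = cong suc (+-suc n (n + 0))

data EvenOdd : ℕ → Set where
  even : ∀ c → EvenOdd (2 * c)
  odd  : ∀ c → EvenOdd (suc (2 * c))

evenOdd : ∀ n → EvenOdd n
evenOdd zero = even 0
evenOdd (suc n) with evenOdd n
... | even c = odd c
... | odd c  = subst EvenOdd (2*[1+n]≡2+2*n c) (even (suc c))

+-cong-%2 : ∀ a b a′ b′ → a % 2 ≡ a′ % 2 → b % 2 ≡ b′ % 2 → (a + b) % 2 ≡ (a′ + b′) % 2
+-cong-%2 a b a′ b′ p q = begin
  (a + b) % 2                 ≡⟨ %-distribˡ-+ a b 2 ⟩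
  (a % 2 + b % 2) % 2         ≡⟨ cong₂ (λ x y → (x + y) % 2) p q ⟩
  (a′ % 2 + b′ % 2) % 2       ≡⟨ %-distribˡ-+ a′ b′ 2 ⟨
  (a′ + b′) % 2               ∎
  where open ≡-Reasoning

[n+n]%2≡0 : ∀ n → (n + n) % 2 ≡ 0
[n+n]%2≡0 n = begin
  (n + n) % 2         ≡⟨ cong (λ m → (n + m) % 2) (+-identityʳ n) ⟨
  (2 * n) % 2         ≡⟨ cong (_% 2) (*-comm 2 n) ⟩
  (n * 2) % 2         ≡⟨ m*n%n≡0 n 2 ⟩
  0                   ∎
  where open ≡-Reasoning

pascal : ∀ n k → suc n C suc k ≡ n C k + n C suc k
pascal n k = sym (nCk+nC[k+1]≡[n+1]C[k+1] n k)

mutual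
  [2a]C[2c]%2≡aCc%2 : ∀ a c → (2 * a C 2 * c) % 2 ≡ (a C c) % 2
  [2a]C[2c]%2≡aCc%2 zero    zero    = refl
  [2a]C[2c]%2≡aCc%2 zero    (suc c) = refl
  [2a]C[2c]%2≡aCc%2 (suc a) zero    = refl
  [2a]C[2c]%2≡aCc%2 (suc a) (suc c) = begin
    (2 * suc a C 2 * suc c) % 2
      ≡⟨ cong₂ (λ n k → (n C k) % 2) (2*[1+n]≡2+2*n a) (2*[1+n]≡2+2*n c) ⟩
    (suc (suc (2 * a)) C suc (suc (2 * c))) % 2
      ≡⟨ cong (_% 2) (pascal (suc (2 * a)) (suc (2 * c))) ⟩
    (suc (2 * a) C suc (2 * c) + suc (2 * a) C suc (suc (2 * c))) % 2
      ≡⟨ +-cong-%2 (suc (2 * a) C suc (2 * c)) (suc (2 * a) C suc (suc (2 * c))) (a C c) (a C suc c)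
            ([1+2a]C[1+2c]%2≡aCc%2 a c) [1+2a]C[2+2c]%2≡aC[1+c]%2 ⟩
    (a C c + a C suc c) % 2
      ≡⟨ cong (_% 2) (nCk+nC[k+1]≡[n+1]C[k+1] a c) ⟩
    (suc a C suc c) % 2 ∎
    where
    open ≡-Reasoning
    [1+2a]C[2+2c]%2≡aC[1+c]%2 : (suc (2 * a) C suc (suc (2 * c))) % 2 ≡ (a C suc c) % 2
    [1+2a]C[2+2c]%2≡aC[1+c]%2 = subst (λ k → (suc (2 * a) C k) % 2 ≡ (a C suc c) % 2)
      (2*[1+n]≡2+2*n c) ([1+2a]C[2c]%2≡aCc%2 a (suc c))

  [2a]C[1+2c]%2≡0 : ∀ a c → (2 * a C suc (2 * c)) % 2 ≡ 0
  [2a]C[1+2c]%2≡0 zero    c = refl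
  [2a]C[1+2c]%2≡0 (suc a) c = begin
    (2 * suc a C suc (2 * c)) % 2
      ≡⟨ cong (λ n → (n C suc (2 * c)) % 2) (2*[1+n]≡2+2*n a) ⟩
    (suc (suc (2 * a)) C suc (2 * c)) % 2
      ≡⟨ cong (_% 2) (pascal (suc (2 * a)) (2 * c)) ⟩
    (suc (2 * a) C 2 * c + suc (2 * a) C suc (2 * c)) % 2
      ≡⟨ +-cong-%2 (suc (2 * a) C 2 * c) (suc (2 * a) C suc (2 * c)) (a C c) (a C c)
            ([1+2a]C[2c]%2≡aCc%2 a c) ([1+2a]C[1+2c]%2≡aCc%2 a c) ⟩
    (a C c + a C c) % 2
      ≡⟨ [n+n]%2≡0 (a C c) ⟩
    0 ∎
    where open ≡-Reasoning

  [1+2a]C[2c]%2≡aCc%2 : ∀ a c → (suc (2 * a) C 2 * c) % 2 ≡ (a C c) % 2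
  [1+2a]C[2c]%2≡aCc%2 a zero    = refl
  [1+2a]C[2c]%2≡aCc%2 a (suc c) = begin
    (suc (2 * a) C 2 * suc c) % 2
      ≡⟨ cong (λ k → (suc (2 * a) C k) % 2) (2*[1+n]≡2+2*n c) ⟩
    (suc (2 * a) C suc (suc (2 * c))) % 2
      ≡⟨ cong (_% 2) (pascal (2 * a) (suc (2 * c))) ⟩
    (2 * a C suc (2 * c) + 2 * a C suc (suc (2 * c))) % 2
      ≡⟨ +-cong-%2 (2 * a C suc (2 * c)) (2 * a C suc (suc (2 * c))) 0 (a C suc c)
            ([2a]C[1+2c]%2≡0 a c) [2a]C[2+2c]%2≡aC[1+c]%2 ⟩
    (a C suc c) % 2 ∎
    where
    open ≡-Reasoning
    [2a]C[2+2c]%2≡aC[1+c]%2 : (2 * a C suc (suc (2 * c))) % 2 ≡ (a C suc c) % 2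
    [2a]C[2+2c]%2≡aC[1+c]%2 = subst (λ k → (2 * a C k) % 2 ≡ (a C suc c) % 2)
      (2*[1+n]≡2+2*n c) ([2a]C[2c]%2≡aCc%2 a (suc c))

  [1+2a]C[1+2c]%2≡aCc%2 : ∀ a c → (suc (2 * a) C suc (2 * c)) % 2 ≡ (a C c) % 2
  [1+2a]C[1+2c]%2≡aCc%2 a c = begin
    (suc (2 * a) C suc (2 * c)) % 2
      ≡⟨ cong (_% 2) (pascal (2 * a) (2 * c)) ⟩
    (2 * a C 2 * c + 2 * a C suc (2 * c)) % 2
      ≡⟨ +-cong-%2 (2 * a C 2 * c) (2 * a C suc (2 * c)) (a C c) 0
           ([2a]C[2c]%2≡aCc%2 a c) ([2a]C[1+2c]%2≡0 a c) ⟩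
    (a C c + 0) % 2
      ≡⟨ cong (_% 2) (+-identityʳ (a C c)) ⟩
    (a C c) % 2 ∎
    where open ≡-Reasoning

oddCount : ℕ → ℕ → ℕ
oddCount k zero    = 0
oddCount k (suc N) = oddCount k N + (N C k) % 2

oddCount-2*[1+N] : ∀ k N → oddCount k (2 * suc N) ≡
                   oddCount k (2 * N) + ((2 * N C k) % 2 + (suc (2 * N) C k) % 2)
oddCount-2*[1+N] k N = begin
  oddCount k (2 * suc N)
    ≡⟨ cong (oddCount k) (2*[1+n]≡2+2*n N) ⟩
  oddCount k (2 * N) + (2 * N C k) % 2 + (suc (2 * N) C k) % 2
    ≡⟨ +-assoc (oddCount k (2 * N)) _ _ ⟩
  oddCount k (2 * N) + ((2 * N C k) % 2 + (suc (2 * N) C k) % 2) ∎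
  where open ≡-Reasoning

oddCount-even : ∀ c N → oddCount (2 * c) (2 * N) ≡ 2 * oddCount c N
oddCount-even c zero    = refl
oddCount-even c (suc N) = begin
  oddCount (2 * c) (2 * suc N)
    ≡⟨ oddCount-2*[1+N] (2 * c) N ⟩
  oddCount (2 * c) (2 * N) + ((2 * N C 2 * c) % 2 + (suc (2 * N) C 2 * c) % 2)
    ≡⟨ cong₂ _+_ (oddCount-even c N) (cong₂ _+_ ([2a]C[2c]%2≡aCc%2 N c) ([1+2a]C[2c]%2≡aCc%2 N c)) ⟩
  2 * oddCount c N + ((N C c) % 2 + (N C c) % 2)
    ≡⟨ cong (λ x → 2 * oddCount c N + ((N C c) % 2 + x)) (+-identityʳ _) ⟨
  2 * oddCount c N + 2 * ((N C c) % 2)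
    ≡⟨ *-distribˡ-+ 2 (oddCount c N) _ ⟨
  2 * oddCount c (suc N) ∎
  where open ≡-Reasoning

oddCount-odd : ∀ c N → oddCount (suc (2 * c)) (2 * N) ≡ oddCount c N
oddCount-odd c zero    = refl
oddCount-odd c (suc N) = begin
  oddCount (suc (2 * c)) (2 * suc N)
    ≡⟨ oddCount-2*[1+N] (suc (2 * c)) N ⟩
  oddCount (suc (2 * c)) (2 * N) + ((2 * N C suc (2 * c)) % 2 + (suc (2 * N) C suc (2 * c)) % 2)
    ≡⟨ cong₂ _+_ (oddCount-odd c N) (cong₂ _+_ ([2a]C[1+2c]%2≡0 N c) ([1+2a]C[1+2c]%2≡aCc%2 N c)) ⟩
  oddCount c (suc N) ∎
  where open ≡-Reasoning

n/2≤f : ∀ n f → n ≤ suc f → n / 2 ≤ f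
n/2≤f zero    f _   = z≤n
n/2≤f (suc n) f n≤f = ≤-pred (≤-trans (m/n<m (suc n) 2 (s≤s (s≤s z≤n))) n≤f)

w₂-fuel[0]≡0 : ∀ f → w₂-fuel f 0 ≡ 0
w₂-fuel[0]≡0 zero    = refl
w₂-fuel[0]≡0 (suc f) = w₂-fuel[0]≡0 f

w₂-fuel-irrelevant : ∀ f g n → n ≤ f → n ≤ g → w₂-fuel f n ≡ w₂-fuel g n
w₂-fuel-irrelevant f       g       zero    _   _   = trans (w₂-fuel[0]≡0 f) (sym (w₂-fuel[0]≡0 g))
w₂-fuel-irrelevant (suc f) (suc g) (suc n) n≤f n≤g =
  cong (λ w → suc n % 2 + w) (w₂-fuel-irrelevant f g (suc n / 2) (n/2≤f (suc n) f n≤f) (n/2≤f (suc n) g n≤g))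

w₂-rec : ∀ n → w₂ n ≡ n % 2 + w₂ (n / 2)
w₂-rec n = begin
  w₂-fuel n n
    ≡⟨ w₂-fuel-irrelevant n (suc n) n ≤-refl (n≤1+n n) ⟩
  n % 2 + w₂-fuel n (n / 2)
    ≡⟨ cong (λ w → n % 2 + w) (w₂-fuel-irrelevant n (n / 2) (n / 2) (n/2≤f n n (n≤1+n n)) ≤-refl) ⟩
  n % 2 + w₂ (n / 2) ∎
  where open ≡-Reasoning

w₂-even : ∀ c → w₂ (2 * c) ≡ w₂ c
w₂-even c = begin
  w₂ (2 * c)                         ≡⟨ w₂-rec (2 * c) ⟩
  (2 * c) % 2 + w₂ ((2 * c) / 2)     ≡⟨ cong (λ m → m % 2 + w₂ (m / 2)) (*-comm 2 c) ⟩
  (c * 2) % 2 + w₂ ((c * 2) / 2)     ≡⟨ cong₂ (λ x y → x + w₂ y) (m*n%n≡0 c 2) (m*n/n≡m c 2) ⟩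
  w₂ c                               ∎
  where open ≡-Reasoning

w₂-odd : ∀ c → w₂ (suc (2 * c)) ≡ suc (w₂ c)
w₂-odd c = begin
  w₂ (suc (2 * c))                         ≡⟨ w₂-rec (suc (2 * c)) ⟩
  suc (2 * c) % 2 + w₂ (suc (2 * c) / 2)   ≡⟨ cong (λ m → suc m % 2 + w₂ (suc m / 2)) (*-comm 2 c) ⟩
  (1 + c * 2) % 2 + w₂ ((1 + c * 2) / 2)   ≡⟨ cong₂ (λ x y → x + w₂ y) ([m+kn]%n≡m%n 1 c 2) [1+2c]/2≡c ⟩
  suc (w₂ c)                               ∎
  where
  open ≡-Reasoning
  [1+2c]/2≡c : (1 + c * 2) / 2 ≡ c
  [1+2c]/2≡c = trans (+-distrib-/ 1 (c * 2) (subst (λ z → 1 + z < 2) (sym (m*n%n≡0 c 2)) ≤-refl))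
                     (m*n/n≡m c 2)

1+c<2*[1+c] : ∀ c → suc c < 2 * suc c
1+c<2*[1+c] c = m<m+n (suc c) z<s

w₂≡0⇒≡0 : ∀ n → w₂ n ≡ 0 → n ≡ 0
w₂≡0⇒≡0 n = go n (<-wellFounded n)
  where
  go : ∀ n → Acc _<_ n → w₂ n ≡ 0 → n ≡ 0
  go n (acc rs) w₂n≡0 with evenOdd n
  ... | even zero    = refl
  ... | even (suc c) = cong (2 *_) (go (suc c) (rs (1+c<2*[1+c] c)) (trans (sym (w₂-even (suc c))) w₂n≡0))
  ... | odd c        = contradiction (trans (sym (w₂-odd c)) w₂n≡0) λ ()

w₂≡1⇒≡2^ : ∀ n → w₂ n ≡ 1 → Σ ℕ (λ j → n ≡ 2 ^ j)
w₂≡1⇒≡2^ n = go n (<-wellFounded n)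
  where
  go : ∀ n → Acc _<_ n → w₂ n ≡ 1 → Σ ℕ (λ j → n ≡ 2 ^ j)
  go n (acc rs) w₂n≡1 with evenOdd n
  ... | even zero    = contradiction w₂n≡1 λ ()
  ... | even (suc c) with go (suc c) (rs (1+c<2*[1+c] c)) (trans (sym (w₂-even (suc c))) w₂n≡1)
  ...   | j , c≡2^j = suc j , cong (2 *_) c≡2^j
  go n (acc rs) w₂n≡1 | odd c = 0 , cong (λ m → suc (2 * m)) (w₂≡0⇒≡0 c (suc-injective (trans (sym (w₂-odd c)) w₂n≡1)))

w₂[2^j]≡1 : ∀ j → w₂ (2 ^ j) ≡ 1
w₂[2^j]≡1 zero    = refl
w₂[2^j]≡1 (suc j) = trans (w₂-even (2 ^ j)) (w₂[2^j]≡1 j)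

oddCount[2^R]*2^w₂≡2^R : ∀ R k → k < 2 ^ R → oddCount k (2 ^ R) * 2 ^ w₂ k ≡ 2 ^ R
oddCount[2^R]*2^w₂≡2^R zero    zero    _         = refl
oddCount[2^R]*2^w₂≡2^R zero    (suc k) (s≤s ())
oddCount[2^R]*2^w₂≡2^R (suc R) k       k<2^[1+R] with evenOdd k
... | even c = begin
  oddCount (2 * c) (2 * 2 ^ R) * 2 ^ w₂ (2 * c)
    ≡⟨ cong₂ (λ x y → x * 2 ^ y) (oddCount-even c (2 ^ R)) (w₂-even c) ⟩
  2 * oddCount c (2 ^ R) * 2 ^ w₂ c
    ≡⟨ *-assoc 2 (oddCount c (2 ^ R)) _ ⟩
  2 * (oddCount c (2 ^ R) * 2 ^ w₂ c)
    ≡⟨ cong (2 *_) (oddCount[2^R]*2^w₂≡2^R R c (*-cancelˡ-< 2 c (2 ^ R) k<2^[1+R])) ⟩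
  2 * 2 ^ R ∎
  where open ≡-Reasoning
... | odd c = begin
  oddCount (suc (2 * c)) (2 * 2 ^ R) * 2 ^ w₂ (suc (2 * c))
    ≡⟨ cong₂ (λ x y → x * 2 ^ y) (oddCount-odd c (2 ^ R)) (w₂-odd c) ⟩
  oddCount c (2 ^ R) * (2 * 2 ^ w₂ c)
    ≡⟨ x*[2*y]≡2*[x*y] (oddCount c (2 ^ R)) (2 ^ w₂ c) ⟩
  2 * (oddCount c (2 ^ R) * 2 ^ w₂ c)
    ≡⟨ cong (2 *_) (oddCount[2^R]*2^w₂≡2^R R c (*-cancelˡ-< 2 c (2 ^ R) (<⇒≤ k<2^[1+R]))) ⟩
  2 * 2 ^ R ∎
  where
  open ≡-Reasoning
  x*[2*y]≡2*[x*y] : ∀ x y → x * (2 * y) ≡ 2 * (x * y)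
  x*[2*y]≡2*[x*y] x y = trans (sym (*-assoc x 2 y)) (trans (cong (_* y) (*-comm x 2)) (*-assoc 2 x y))

k<2^r[k] : ∀ k → k < 2 ^ r k
k<2^r[k] k = ≰⇒> λ 2^r[k]≤k → 1+n≰n (begin
  1 + ⌊log₂ k ⌋          ≡⟨ +-comm 1 ⌊log₂ k ⌋ ⟩
  r k                    ≡⟨ ⌊log₂[2^n]⌋≡n (r k) ⟨
  ⌊log₂ 2 ^ r k ⌋        ≤⟨ ⌊log₂⌋-mono-≤ 2^r[k]≤k ⟩
  ⌊log₂ k ⌋              ∎)
  where open ≤-Reasoning

negOnePow≡1-2*n%2 : ∀ n → negOnePow n ≡ + 1 ℤ.- + 2 ℤ.* + (n % 2)
negOnePow≡1-2*n%2 n with n % 2 | m%n<n n 2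
... | 0           | _           = refl
... | 1           | _           = refl
... | suc (suc _) | s≤s (s≤s ())

signSum≡N-2*oddCount : ∀ k N → signSum k N ≡ + N ℤ.- + 2 ℤ.* + oddCount k N
signSum≡N-2*oddCount k zero    = refl
signSum≡N-2*oddCount k (suc N) = begin
  signSum k N ℤ.+ negOnePow (N C k)
    ≡⟨ cong₂ ℤ._+_ (signSum≡N-2*oddCount k N) (negOnePow≡1-2*n%2 (N C k)) ⟩
  (+ N ℤ.- + 2 ℤ.* + A) ℤ.+ (+ 1 ℤ.- + 2 ℤ.* + p)
    ≡⟨ regroup (+ N) (+ A) (+ p) ⟩
  (+ 1 ℤ.+ + N) ℤ.- + 2 ℤ.* (+ A ℤ.+ + p)
    ≡⟨ cong₂ (λ x y → x ℤ.- + 2 ℤ.* y) (ℤ.pos-+ 1 N) (ℤ.pos-+ A p) ⟨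
  + suc N ℤ.- + 2 ℤ.* + oddCount k (suc N) ∎
  where
  open ≡-Reasoning
  A = oddCount k N
  p = (N C k) % 2
  regroup : ∀ n a x → (n ℤ.- + 2 ℤ.* a) ℤ.+ (+ 1 ℤ.- + 2 ℤ.* x) ≡ (+ 1 ℤ.+ n) ℤ.- + 2 ℤ.* (a ℤ.+ x)
  regroup = solve-∀

signSum*P≡[P-1]*N : ∀ k N P → oddCount k N * (2 * P) ≡ N →
                    signSum k N ℤ.* + P ≡ (+ P ℤ.- + 1) ℤ.* + N
signSum*P≡[P-1]*N k N P A*2P≡N = begin
  signSum k N ℤ.* + P
    ≡⟨ cong (ℤ._* + P) (signSum≡N-2*oddCount k N) ⟩
  (+ N ℤ.- + 2 ℤ.* + A) ℤ.* + P
    ≡⟨ cong (λ n → (n ℤ.- + 2 ℤ.* + A) ℤ.* + P) N≡A*2P ⟩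
  (+ A ℤ.* (+ 2 ℤ.* + P) ℤ.- + 2 ℤ.* + A) ℤ.* + P
    ≡⟨ factor (+ A) (+ P) ⟩
  (+ P ℤ.- + 1) ℤ.* (+ A ℤ.* (+ 2 ℤ.* + P))
    ≡⟨ cong ((+ P ℤ.- + 1) ℤ.*_) N≡A*2P ⟨
  (+ P ℤ.- + 1) ℤ.* + N ∎
  where
  open ≡-Reasoning
  A = oddCount k N
  N≡A*2P : + N ≡ + A ℤ.* (+ 2 ℤ.* + P)
  N≡A*2P = trans (cong +_ (sym A*2P≡N)) (trans (ℤ.pos-* A (2 * P)) (cong (+ A ℤ.*_) (ℤ.pos-* 2 P)))
  factor : ∀ a p → (a ℤ.* (+ 2 ℤ.* p) ℤ.- + 2 ℤ.* a) ℤ.* p ≡ (p ℤ.- + 1) ℤ.* (a ℤ.* (+ 2 ℤ.* p))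
  factor = solve-∀

p*q′≡p′*q⇒p/q≡p′/q′ : ∀ p q p′ q′ .{{_ : NonZero q}} .{{_ : NonZero q′}} →
                      p ℤ.* + q′ ≡ p′ ℤ.* + q → p ℚ./ q ≡ p′ ℚ./ q′
p*q′≡p′*q⇒p/q≡p′/q′ p (suc q-1) p′ (suc q′-1) eq = fromℚᵘ-cong {mkℚᵘ p q-1} {mkℚᵘ p′ q′-1} (*≡* eq)

p/q≡0⇒p≡0 : ∀ p q .{{_ : NonZero q}} → p ℚ./ q ≡ 0ℚ → p ≡ + 0
p/q≡0⇒p≡0 p (suc q-1) eq with fromℚᵘ-injective {mkℚᵘ p q-1} {mkℚᵘ (+ 0) 0} eq
... | *≡* p*1≡0 = trans (sym (ℤ.*-identityʳ p)) p*1≡0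

c₀≡closedForm : ∀ k .{{_ : NonZero k}} → c₀ k ≡ closedForm (w₂ k)
c₀≡closedForm k with w₂ k in w₂[k]≡w | oddCount[2^R]*2^w₂≡2^R (r k) k (k<2^r[k] k)
... | zero  | _ = contradiction (w₂≡0⇒≡0 k w₂[k]≡w) (≢-nonZero⁻¹ k)
... | suc V | A*2^w≡N =
  p*q′≡p′*q⇒p/q≡p′/q′ (signSum k (2 ^ r k)) (2 ^ r k) (+ (2 ^ V) ℤ.- + 1) (2 ^ V)
    {{m^n≢0 2 (r k)}} {{m^n≢0 2 V}} (signSum*P≡[P-1]*N k (2 ^ r k) (2 ^ V) A*2^w≡N)

w₂-nonZero : ∀ n .{{_ : NonZero n}} → NonZero (w₂ n)
w₂-nonZero n = ≢-nonZero λ w₂n≡0 → ≢-nonZero⁻¹ n (w₂≡0⇒≡0 n w₂n≡0)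

-- NonZero is needed: by truncated subtraction closedForm 0 is 0ℚ as well.
closedForm≡0⇒≡1 : ∀ w .{{_ : NonZero w}} → closedForm w ≡ 0ℚ → w ≡ 1
closedForm≡0⇒≡1 (suc V) eq = cong suc (begin
  V                  ≡⟨ ⌊log₂[2^n]⌋≡n V ⟨
  ⌊log₂ 2 ^ V ⌋      ≡⟨ cong ⌊log₂_⌋ 2^V≡1 ⟩
  0                  ∎)
  where
  open ≡-Reasoning
  2^V≡1 : 2 ^ V ≡ 1
  2^V≡1 = ℤ.+-injective (ℤ.i-j≡0⇒i≡j _ _ (p/q≡0⇒p≡0 _ (2 ^ V) {{m^n≢0 2 V}} eq))

mainTheorem1 : (k : ℕ) → 2 ≤ k →
    (c₀ k ≡ closedForm (w₂ k)) × ((c₀ k ≡ 0ℚ) ⇔ Σ ℕ (λ j → k ≡ 2 ^ j))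
mainTheorem1 k@(suc _) _ = c₀≡closedForm k , mk⇔ c₀≡0⇒power-of-two power-of-two⇒c₀≡0
  where
  c₀≡0⇒power-of-two : c₀ k ≡ 0ℚ → Σ ℕ (λ j → k ≡ 2 ^ j)
  c₀≡0⇒power-of-two c₀≡0 =
    w₂≡1⇒≡2^ k (closedForm≡0⇒≡1 (w₂ k) {{w₂-nonZero k}} (trans (sym (c₀≡closedForm k)) c₀≡0))
  power-of-two⇒c₀≡0 : Σ ℕ (λ j → k ≡ 2 ^ j) → c₀ k ≡ 0ℚ
  power-of-two⇒c₀≡0 (j , k≡2^j) =
    trans (c₀≡closedForm k) (cong closedForm (trans (cong w₂ k≡2^j) (w₂[2^j]≡1 j)))
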